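{- If $G$ is an oriented graph whose underlying graph is a $2$-tree, then $\chi_s(G)\leq 3$.
   Context: An oriented graph is a $(1,0)$-mixed graph: a loopless digraph with at most one arc between any pair of vertices. A simple homomorphism $\phi: G\to_s H$ of oriented graphs is a map $V(G)\to V(H)$ such that either $|V(G)|=1$, or $\phi$ is non-constant and for every arc $uv$ of $G$ with $\phi(u)\neq\phi(v)$, $\phi(u)\phi(v)$ is an arc of $H$ (same direction). $\chi_s(G)$ is the least number of vertices of an oriented graph $H$ with $G\to_s H$. -}

module Defs where

open import Data.Nat using (ℕ; _≤_; _<_)
open import Data.Fin using (Fin; toℕ)
open import Data.Bool using (Bool; true; false)
open import Data.Product using (Σ; ∃; ∃-syntax; _×_; _,_)
open import Data.Sum using (_⊎_)
open import Relation.Binary.PropositionalEquality using (_≡_; _≢_)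
open import Relation.Nullary using (¬_)
open import Function.Bundles using (_↔_; Inverse)

record OrientedGraph (n : ℕ) : Set where
  field
    arc       : Fin n → Fin n → Bool
    loopless  : ∀ u → arc u u ≡ false
    oriented  : ∀ u v → arc u v ≡ true → arc v u ≡ false
open OrientedGraph public

Adj : ∀ {n} → OrientedGraph n → Fin n → Fin n → Set
Adj G u v = (arc G u v ≡ true) ⊎ (arc G v u ≡ true)

-- 2-trees: K2 is a 2-tree, and adding a new vertex adjacent to exactly the
-- two ends of an existing edge yields a 2-tree.  Equivalently, a
-- construction ordering ord (a bijection from positions to vertices) with
-- positions 0,1 adjacent and each later position k adjacent to exactly two
-- earlier positions i, j, which are themselves adjacent.
IsTwoTreeOrder : ∀ {n} → OrientedGraph n → (Fin n ↔ Fin n) → Set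
IsTwoTreeOrder {n} G ord =
  (∃[ p ] ∃[ q ] (toℕ p ≡ 0 × toℕ q ≡ 1 × Adj G (f p) (f q))) ×
  (∀ (k : Fin n) → 2 ≤ toℕ k →
     ∃[ i ] ∃[ j ] (toℕ i < toℕ k × toℕ j < toℕ k × i ≢ j ×
        Adj G (f i) (f j) × Adj G (f k) (f i) × Adj G (f k) (f j) ×
        (∀ (l : Fin n) → toℕ l < toℕ k → Adj G (f k) (f l) → (l ≡ i) ⊎ (l ≡ j))))
  where
    f : Fin n → Fin n
    f = Inverse.to ord

UnderlyingTwoTree : ∀ {n} → OrientedGraph n → Set
UnderlyingTwoTree {n} G = 2 ≤ n × ∃[ ord ] IsTwoTreeOrder G ord

SimpleHom : ∀ {n m} → OrientedGraph n → OrientedGraph m → (Fin n → Fin m) → Set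
SimpleHom {n} G H φ =
  ((n ≡ 1) ⊎ (∃[ u ] ∃[ v ] (φ u ≢ φ v))) ×
  (∀ u v → arc G u v ≡ true → φ u ≢ φ v → arc H (φ u) (φ v) ≡ true)

SimpleChromaticAtMost : ∀ {n} → OrientedGraph n → ℕ → Set
SimpleChromaticAtMost G k =
  ∃[ m ] (m ≤ k × Σ (OrientedGraph m) (λ H → ∃[ φ ] SimpleHom G H φ))

-- Colour with the directed triangle 0 → 1 → 2 → 0, where an arc may join equal colours or go
-- one step forward.  Any two colours are equal or one step apart, so whatever the orientations
-- of the arcs from a new vertex to the two ends of an edge, the triangle offers a colour that is
-- admissible for both.  Colouring a 2-tree along its construction order therefore gives a simple
-- homomorphism to the triangle, non-constant because the initial edge gets two distinct colours.
module Submission where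

open import Defs
open import Data.Nat using (ℕ; zero; suc; _≤_; _<_; _≤?_; s≤s; z≤n)
open import Data.Nat.Properties using (≤-irrelevant; ≤-refl)
open import Data.Fin using (Fin; toℕ; zero; suc)
open import Data.Fin.Properties using (_≟_; toℕ-injective; <-cmp)
open import Data.Fin.Induction using (<-wellFounded)
open import Data.Bool using (Bool; true; false)
open import Data.Product using (∃-syntax; _×_; _,_; proj₁; proj₂; map₂; swap)
open import Data.Sum using (_⊎_; inj₁; inj₂)
open import Function.Bundles using (_↔_; Inverse)
open import Induction.WellFounded using (module All; module FixPoint)
open import Level using (0ℓ)
open import Relation.Binary using (tri<; tri≈; tri>)
open import Relation.Binary.PropositionalEquality using (_≡_; _≢_; refl; sym; trans; cong; cong₂; subst; subst₂)
open import Relation.Nullary using (¬_; Dec; yes; no; contradiction)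
open import Relation.Nullary.Decidable using (does; dec-true; dec-false)

Colour : Set
Colour = Fin 3

next : Colour → Colour
next zero             = suc zero
next (suc zero)       = suc (suc zero)
next (suc (suc zero)) = zero

next³≡id : ∀ c → next (next (next c)) ≡ c
next³≡id zero             = refl
next³≡id (suc zero)       = refl
next³≡id (suc (suc zero)) = refl

next-irreflexive : ∀ c → c ≢ next c
next-irreflexive zero             ()
next-irreflexive (suc zero)       ()
next-irreflexive (suc (suc zero)) ()

next²-irreflexive : ∀ c → c ≢ next (next c)
next²-irreflexive zero             ()
next²-irreflexive (suc zero)       ()
next²-irreflexive (suc (suc zero)) ()

distinct⇒next : ∀ {a b} → a ≢ b → b ≡ next a ⊎ a ≡ next b
distinct⇒next {zero}             {zero}             a≢b = contradiction refl a≢b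
distinct⇒next {zero}             {suc zero}         _   = inj₁ refl
distinct⇒next {zero}             {suc (suc zero)}   _   = inj₂ refl
distinct⇒next {suc zero}         {zero}             _   = inj₂ refl
distinct⇒next {suc zero}         {suc zero}         a≢b = contradiction refl a≢b
distinct⇒next {suc zero}         {suc (suc zero)}   _   = inj₁ refl
distinct⇒next {suc (suc zero)}   {zero}             _   = inj₁ refl
distinct⇒next {suc (suc zero)}   {suc zero}         _   = inj₂ refl
distinct⇒next {suc (suc zero)}   {suc (suc zero)}   a≢b = contradiction refl a≢b

arc⇒next : ∀ {c d} → does (d ≟ next c) ≡ true → d ≡ next c
arc⇒next {c} {d} with d ≟ next c
... | yes d≡c⁺ = λ _ → d≡c⁺
... | no  _    = λ ()

triangle : OrientedGraph 3
triangle = record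
  { arc      = λ c d → does (d ≟ next c)
  ; loopless = λ c → dec-false (c ≟ next c) (next-irreflexive c)
  ; oriented = λ c d c→d → dec-false (c ≟ next d) (no-back-arc (arc⇒next c→d))
  }
  where
    no-back-arc : ∀ {c d} → d ≡ next c → c ≢ next d
    no-back-arc {c} refl = next²-irreflexive c

_↝_ : Colour → Colour → Set
c ↝ d = c ≡ d ⊎ d ≡ next c

↝⇒arc : ∀ {c d} → c ↝ d → c ≢ d → arc triangle c d ≡ true
↝⇒arc (inj₁ c≡d)  c≢d = contradiction c≡d c≢d
↝⇒arc {c} {d} (inj₂ d≡c⁺) _ = dec-true (d ≟ next c) d≡c⁺

-- Toward (arc G x y) (φ x) (φ y) is the constraint the arc between adjacent x and y puts on φ,
-- whichever way it points.
Toward : Bool → Colour → Colour → Set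
Toward true  c d = c ↝ d
Toward false c d = d ↝ c

Toward-refl : ∀ s c → Toward s c c
Toward-refl true  c = inj₁ refl
Toward-refl false c = inj₁ refl

extend-arc : ∀ {a b} s t → b ≡ next a → ∃[ c ] Toward s c a × Toward t c b
extend-arc {a} true  true  refl = a , inj₁ refl , inj₂ refl
extend-arc {a} true  false refl = next (next a) , inj₂ (sym (next³≡id a)) , inj₂ refl
extend-arc {a} false true  refl = a , inj₁ refl , inj₂ refl
extend-arc {a} false false refl = next a , inj₂ refl , inj₁ refl

extend-edge : ∀ a b s t → ∃[ c ] Toward s c a × Toward t c b
extend-edge a b s t with a ≟ b
... | yes refl = a , Toward-refl s a , Toward-refl t a
... | no  a≢b  with distinct⇒next a≢b
...   | inj₁ b≡a⁺ = extend-arc s t b≡a⁺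
...   | inj₂ a≡b⁺ = map₂ swap (extend-arc t s a≡b⁺)

extend-vertex : ∀ a s → ∃[ c ] c ≢ a × Toward s c a
extend-vertex a true  = next (next a) , (λ eq → next²-irreflexive a (sym eq)) , inj₂ (sym (next³≡id a))
extend-vertex a false = next a , (λ eq → next-irreflexive a (sym eq)) , inj₂ refl

module _ {n} (G : OrientedGraph n) where

  Toward-arc : ∀ {x y c d} → arc G x y ≡ true → Toward (arc G x y) c d → c ↝ d
  Toward-arc x→y toward rewrite x→y = toward

  Toward-arc˘ : ∀ {x y c d} → arc G y x ≡ true → Toward (arc G x y) c d → d ↝ c
  Toward-arc˘ {x} {y} y→x toward rewrite oriented G y x y→x = toward

  ↝-colouring⇒simpleHom : (φ : Fin n → Colour) → ∃[ u ] ∃[ v ] φ u ≢ φ v →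
                          (∀ u v → arc G u v ≡ true → φ u ↝ φ v) → SimpleHom G triangle φ
  ↝-colouring⇒simpleHom φ nonConstant respects =
    inj₂ nonConstant , λ u v u→v φu≢φv → ↝⇒arc (respects u v u→v) φu≢φv

below-two : ∀ {i k} → i < k → ¬ 2 ≤ k → i ≡ 0 × k ≡ 1
below-two {zero}  {suc zero}    _ _   = refl , refl
below-two {_}     {suc (suc _)} _ k≱2 = contradiction (s≤s (s≤s z≤n)) k≱2
below-two {suc _} {suc zero}    (s≤s ()) _

module TwoTreeColouring {n} (G : OrientedGraph n) (ord : Fin n ↔ Fin n) (T : IsTwoTreeOrder G ord) where

  vertexAt positionOf : Fin n → Fin n
  vertexAt   = Inverse.to ord
  positionOf = Inverse.from ord

  first second : Fin n
  first  = proj₁ (proj₁ T)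
  second = proj₁ (proj₂ (proj₁ T))

  first≡0 : toℕ first ≡ 0
  first≡0 = proj₁ (proj₂ (proj₂ (proj₁ T)))

  second≡1 : toℕ second ≡ 1
  second≡1 = proj₁ (proj₂ (proj₂ (proj₂ (proj₁ T))))

  module _ (k : Fin n) (2≤k : 2 ≤ toℕ k) where

    parent₁ parent₂ : Fin n
    parent₁ = proj₁ (proj₂ T k 2≤k)
    parent₂ = proj₁ (proj₂ (proj₂ T k 2≤k))

    parent₁<k : toℕ parent₁ < toℕ k
    parent₁<k = proj₁ (proj₂ (proj₂ (proj₂ T k 2≤k)))

    parent₂<k : toℕ parent₂ < toℕ k
    parent₂<k = proj₁ (proj₂ (proj₂ (proj₂ (proj₂ T k 2≤k))))

    earlierNeighbour⇒parent : ∀ l → toℕ l < toℕ k → Adj G (vertexAt k) (vertexAt l) → l ≡ parent₁ ⊎ l ≡ parent₂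
    earlierNeighbour⇒parent = proj₂ (proj₂ (proj₂ (proj₂ (proj₂ (proj₂ (proj₂ (proj₂ (proj₂ T k 2≤k))))))))

  direction : Fin n → Fin n → Bool
  direction k l = arc G (vertexAt k) (vertexAt l)

  secondColour : Colour
  secondColour = proj₁ (extend-vertex zero (direction second first))

  rootColour : ℕ → Colour
  rootColour zero    = zero
  rootColour (suc _) = secondColour

  extendColour : (k : Fin n) → 2 ≤ toℕ k → Colour → Colour → Colour
  extendColour k 2≤k a b = proj₁ (extend-edge a b (direction k (parent₁ k 2≤k)) (direction k (parent₂ k 2≤k)))

  extendColour-toward : ∀ k (2≤k : 2 ≤ toℕ k) a b →
                        Toward (direction k (parent₁ k 2≤k)) (extendColour k 2≤k a b) a ×
                        Toward (direction k (parent₂ k 2≤k)) (extendColour k 2≤k a b) b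
  extendColour-toward k 2≤k a b = proj₂ (extend-edge a b (direction k (parent₁ k 2≤k)) (direction k (parent₂ k 2≤k)))

  colourStep : (k : Fin n) → (∀ {l} → toℕ l < toℕ k → Colour) → Colour
  colourStep k rec with 2 ≤? toℕ k
  ... | yes 2≤k = extendColour k 2≤k (rec (parent₁<k k 2≤k)) (rec (parent₂<k k 2≤k))
  ... | no  _   = rootColour (toℕ k)

  colourStep-cong : ∀ k {rec rec′ : ∀ {l} → toℕ l < toℕ k → Colour} →
                    (∀ {l} (l<k : toℕ l < toℕ k) → rec l<k ≡ rec′ l<k) → colourStep k rec ≡ colourStep k rec′
  colourStep-cong k rec≗rec′ with 2 ≤? toℕ k
  ... | yes 2≤k = cong₂ (extendColour k 2≤k) (rec≗rec′ _) (rec≗rec′ _)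
  ... | no  _   = refl

  colour : Fin n → Colour
  colour = All.wfRec <-wellFounded 0ℓ (λ _ → Colour) colourStep

  colour-unfold : ∀ k → colour k ≡ colourStep k (λ {l} _ → colour l)
  colour-unfold k = FixPoint.unfold-wfRec <-wellFounded (λ _ → Colour) colourStep colourStep-cong {k}

  colour-parents : ∀ k (2≤k : 2 ≤ toℕ k) →
                   colour k ≡ extendColour k 2≤k (colour (parent₁ k 2≤k)) (colour (parent₂ k 2≤k))
  colour-parents k 2≤k = trans (colour-unfold k) step
    where
      step : colourStep k (λ {l} _ → colour l) ≡ extendColour k 2≤k (colour (parent₁ k 2≤k)) (colour (parent₂ k 2≤k))
      step with 2 ≤? toℕ k
      ... | yes 2≤k′ rewrite ≤-irrelevant 2≤k′ 2≤k = refl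
      ... | no  k≱2  = contradiction 2≤k k≱2

  colour-root : ∀ k → ¬ 2 ≤ toℕ k → colour k ≡ rootColour (toℕ k)
  colour-root k k≱2 = trans (colour-unfold k) step
    where
      step : colourStep k (λ {l} _ → colour l) ≡ rootColour (toℕ k)
      step with 2 ≤? toℕ k
      ... | yes 2≤k = contradiction 2≤k k≱2
      ... | no  _   = refl

  colour-first : colour first ≡ zero
  colour-first = trans (colour-root first first≱2) (cong rootColour first≡0)
    where
      first≱2 : ¬ 2 ≤ toℕ first
      first≱2 2≤first = contradiction (subst (2 ≤_) first≡0 2≤first) λ ()

  colour-second : colour second ≡ secondColour
  colour-second = trans (colour-root second second≱2) (cong rootColour second≡1)
    where
      second≱2 : ¬ 2 ≤ toℕ second
      second≱2 2≤second = contradiction (subst (2 ≤_) second≡1 2≤second) λ { (s≤s ()) }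

  first≢second : colour first ≢ colour second
  first≢second eq = proj₁ (proj₂ (extend-vertex zero (direction second first))) (trans (sym colour-second) (trans (sym eq) colour-first))

  colour-toward-parent : ∀ a b (2≤b : 2 ≤ toℕ b) → a ≡ parent₁ b 2≤b ⊎ a ≡ parent₂ b 2≤b →
                         Toward (direction b a) (colour b) (colour a)
  colour-toward-parent a b 2≤b a-parent =
    subst (λ c → Toward (direction b a) c (colour a)) (sym (colour-parents b 2≤b)) (toward a-parent)
    where
      c₁ c₂ : Colour
      c₁ = colour (parent₁ b 2≤b)
      c₂ = colour (parent₂ b 2≤b)

      toward : a ≡ parent₁ b 2≤b ⊎ a ≡ parent₂ b 2≤b → Toward (direction b a) (extendColour b 2≤b c₁ c₂) (colour a)
      toward (inj₁ refl) = proj₁ (extendColour-toward b 2≤b c₁ c₂)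
      toward (inj₂ refl) = proj₂ (extendColour-toward b 2≤b c₁ c₂)

  colour-toward-root : ∀ a b → toℕ a ≡ 0 → toℕ b ≡ 1 → Toward (direction b a) (colour b) (colour a)
  colour-toward-root a b a≡0 b≡1
    with toℕ-injective (trans a≡0 (sym first≡0)) | toℕ-injective (trans b≡1 (sym second≡1))
  ... | refl | refl = subst₂ (Toward (direction second first)) (sym colour-second) (sym colour-first)
                        (proj₂ (proj₂ (extend-vertex zero (direction second first))))

  colour-toward : ∀ a b → toℕ a < toℕ b → Adj G (vertexAt b) (vertexAt a) →
                  Toward (direction b a) (colour b) (colour a)
  colour-toward a b a<b adj = byPosition (2 ≤? toℕ b)
    where
      byPosition : Dec (2 ≤ toℕ b) → Toward (direction b a) (colour b) (colour a)
      byPosition (yes 2≤b) = colour-toward-parent a b 2≤b (earlierNeighbour⇒parent b 2≤b a a<b adj)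
      byPosition (no  b≱2) = colour-toward-root a b (proj₁ (below-two a<b b≱2)) (proj₂ (below-two a<b b≱2))

  colour-arc : ∀ a b → direction a b ≡ true → colour a ↝ colour b
  colour-arc a b a→b with <-cmp a b
  ... | tri< a<b _ _ = Toward-arc˘ G a→b (colour-toward a b a<b (inj₂ a→b))
  ... | tri> _ _ b<a = Toward-arc G a→b (colour-toward b a b<a (inj₁ a→b))
  ... | tri≈ _ refl _ = contradiction (trans (sym a→b) (loopless G (vertexAt a))) λ ()

  φ : Fin n → Colour
  φ v = colour (positionOf v)

  open Inverse ord using () renaming (strictlyInverseˡ to vertexAt∘positionOf; strictlyInverseʳ to positionOf∘vertexAt)

  φ-nonConstant : φ (vertexAt first) ≢ φ (vertexAt second)
  φ-nonConstant = subst₂ _≢_ (cong colour (sym (positionOf∘vertexAt first)))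
                             (cong colour (sym (positionOf∘vertexAt second))) first≢second

  φ-arc : ∀ u v → arc G u v ≡ true → φ u ↝ φ v
  φ-arc u v u→v = colour-arc (positionOf u) (positionOf v)
    (subst₂ (λ x y → arc G x y ≡ true) (sym (vertexAt∘positionOf u)) (sym (vertexAt∘positionOf v)) u→v)

  φ-simpleHom : SimpleHom G triangle φ
  φ-simpleHom = ↝-colouring⇒simpleHom G φ (vertexAt first , vertexAt second , φ-nonConstant) φ-arc

mainTheorem17 : ∀ (n : ℕ) (G : OrientedGraph n) → UnderlyingTwoTree G → SimpleChromaticAtMost G 3
mainTheorem17 n G (_ , ord , T) = 3 , ≤-refl , triangle , φ , φ-simpleHom
  where open TwoTreeColouring G ord T
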